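{- Let $n$ and $k$ be integers with $1<k<n$. For a space bound $s$ and a string $b\in\{0,1\}^n$ put $S_{b,s}=\{x\in\{0,1\}^n \mid \mathrm{KS}^s(x\mid b)<k\}$, and let $\mathcal{S}_k=\{S_{b,s} \mid b\in\{0,1\}^n,\ s\in\mathbb{N}\}$. Then $\mathcal{S}_k$ is a relevant system: every set in $\mathcal{S}_k$ has fewer than $2^k$ elements, and $\mathcal{S}_k$ consists of $2^{O(n)}$ distinct sets (at most $2^{cn}$ for a constant $c$ not depending on $n$ and $k$).
   Context: $\mathrm{KS}^s(x\mid y)$ denotes space-bounded conditional Kolmogorov complexity: for a fixed optimal two-argument Turing machine $\mathcal{U}$, it is the length of a shortest program $p$ such that $\mathcal{U}(p,y)=x$ and the computation of $\mathcal{U}(p,y)$ uses at most $s$ cells of memory. A system $\mathcal{S}$ of subsets of $\{0,1\}^n$ is called relevant (for the parameter $k$) if each $S\in\mathcal{S}$ contains fewer than $2^k$ elements and $\mathcal{S}$ contains $2^{O(n)}$ sets. -}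

module Defs where

open import Data.Nat using (ℕ; zero; suc; _+_; _*_; _^_; _≤_; _<_; _≡ᵇ_)
open import Data.Bool using (Bool; true; false; if_then_else_)
open import Data.Maybe using (Maybe; just; nothing)
open import Data.Fin using (Fin)
open import Data.List using (List; []; _∷_; length)
open import Data.Vec using (Vec; toList)
open import Data.Product using (_×_; _,_; ∃)
open import Relation.Binary.PropositionalEquality using (_≡_)

-- A machine has a read-only "program" tape holding p, a read-only
-- "auxiliary" tape holding the condition y, and one one-sided work
-- tape (initially blank).  Tape symbols are blank (nothing), 0, 1.
-- Memory used = cells of the work tape visited by the work head.
-- The output is the binary string written on the work tape from
-- cell 0 up to the first blank, when the machine halts.

Sym : Set
Sym = Maybe Bool

data Move : Set where
  L R N : Move

move : Move → ℕ → ℕ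
move L zero    = zero
move L (suc i) = i
move R i       = suc i
move N i       = i

record TM : Set where
  field
    nstates : ℕ
    start   : Fin nstates
    halting : Fin nstates → Bool
    -- δ state (program-tape symbol) (aux-tape symbol) (work-tape symbol)
    --   = (new state , written work symbol , program move , aux move , work move)
    δ       : Fin nstates → Sym → Sym → Sym →
              Fin nstates × Sym × Move × Move × Move

readTape : List Bool → ℕ → Sym
readTape []       _       = nothing
readTape (b ∷ bs) zero    = just b
readTape (b ∷ bs) (suc i) = readTape bs i

record Config (M : TM) : Set where
  constructor cfg
  field
    state : Fin (TM.nstates M)
    ph    : ℕ          -- program head
    ah    : ℕ          -- auxiliary head
    wh    : ℕ          -- work head
    work  : ℕ → Sym

open Config public

initial : (M : TM) → Config M
initial M = cfg (TM.start M) 0 0 0 (λ _ → nothing)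

step : (M : TM) → List Bool → List Bool → Config M → Config M
step M p y c with TM.halting M (state c)
... | true  = c
... | false with TM.δ M (state c) (readTape p (ph c)) (readTape y (ah c)) (work c (wh c))
...   | q' , w , mp , ma , mw =
        cfg q' (move mp (ph c)) (move ma (ah c)) (move mw (wh c))
            (λ i → if i ≡ᵇ wh c then w else work c i)

run : (M : TM) → List Bool → List Bool → ℕ → Config M
run M p y zero    = initial M
run M p y (suc t) = step M p y (run M p y t)

TapeOutput : (ℕ → Sym) → List Bool → Set
TapeOutput tape []       = tape 0 ≡ nothing
TapeOutput tape (b ∷ bs) = (tape 0 ≡ just b) × TapeOutput (λ i → tape (suc i)) bs

Computes : (M : TM) → (p y : List Bool) → (s : ℕ) → (x : List Bool) → Set
Computes M p y s x =
  ∃ λ t → (TM.halting M (state (run M p y t)) ≡ true)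
        × (∀ t' → t' ≤ t → wh (run M p y t') < s)
        × TapeOutput (work (run M p y t)) x

Optimal : TM → Set
Optimal U = (M : TM) → ∃ λ c → ∀ p y s x → Computes M p y s x →
  ∃ λ p' → (length p' ≤ length p + c) × Computes U p' y (c * s + c) x

-- KS^s_U(x | y) < k  (unfolded: some program of length < k works)
KSLess : (U : TM) → (s : ℕ) → (x y : List Bool) → (k : ℕ) → Set
KSLess U s x y k = ∃ λ p → (length p < k) × Computes U p y s x

SetS : (U : TM) → (n k : ℕ) → Vec Bool n → ℕ → Vec Bool n → Set
SetS U n k b s x = KSLess U s (toList x) (toList b) k

SameSet : {n : ℕ} → (Vec Bool n → Set) → (Vec Bool n → Set) → Set
SameSet {n} A B = (x : Vec Bool n) → (A x → B x) × (B x → A x)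

-- A set S_{b,s} has fewer than 2^k elements because distinct elements need
-- distinct programs of length < k (machines are deterministic), and there are
-- only 2^k - 1 such programs.  For the number of sets: enlarging the space
-- bound only enlarges S_{b,s}, so for fixed b the sets form a chain, and a set
-- in a chain is determined by its cardinality, which is < 2^k < 2^n.  Hence
-- S_{b,s} is determined by the pair (b, |S_{b,s}|), of which there are at most
-- 2^n · 2^n.  Cardinalities need membership to be decidable; since the bound
-- to be proved is itself decidable, excluded middle for the finitely many
-- memberships involved may be assumed.
module Submission where

open import Defs
open import Data.Nat using (ℕ; _*_; _^_; _≤_; _<_)
open import Data.Bool using (Bool)
open import Data.Vec using (Vec)
open import Data.List using (List; length)
open import Data.List.Relation.Unary.All using (All)
open import Data.List.Relation.Unary.AllPairs using (AllPairs)
open import Data.List.Relation.Unary.Unique.Propositional using (Unique)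
open import Data.Product using (_×_; _,_; ∃; proj₁; proj₂)
open import Relation.Nullary using (¬_)

open import Data.Nat using (zero; suc; z≤n; s≤s; pred; _+_; _≤′_; ≤′-refl; ≤′-step; _≤?_)
open import Data.Nat.Properties
open import Data.Nat.DivMod using (_%_; [m+kn]%n≡m%n; m<n⇒m%n≡m)
open import Data.Bool using (true; false)
open import Data.Fin using (Fin; zero; suc; fromℕ<) renaming (_<_ to _<ᶠ_)
import Data.Fin.Properties as Fin
open import Data.Vec using ([]; _∷_)
import Data.Vec.Properties as Vec
open import Data.List using ([]; _∷_; lookup; filter; cartesianProductWith)
open import Data.List.Membership.Propositional using (_∈_)
open import Data.List.Membership.Propositional.Properties
  using (∈-lookup; ∈-filter⁺; ∈-filter⁻; ∈-cartesianProductWith⁺)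
open import Data.List.Relation.Unary.Any using (here; there)
open import Data.List.Relation.Unary.All using ([]; _∷_)
import Data.List.Relation.Unary.All as All
open import Data.List.Relation.Unary.All.Properties using (all-filter)
open import Data.List.Relation.Unary.AllPairs using ([]; _∷_)
import Data.List.Relation.Unary.Unique.Propositional.Properties as Unique
open import Data.List.Relation.Binary.Sublist.Propositional using (_⊆_; ⊆-refl)
import Data.List.Relation.Binary.Sublist.Propositional.Properties as Sublist
open import Data.List.Relation.Binary.Equality.Propositional using (≋⇒≡)
open import Data.Maybe.Properties using (just-injective)
open import Data.Sum using (inj₁; inj₂)
open import Function using (Injective)
open import Level using (0ℓ)
open import Relation.Binary.Definitions using (tri<; tri≈; tri>)
open import Relation.Binary.PropositionalEquality
  using (_≡_; _≢_; refl; sym; trans; cong; cong₂; subst; module ≡-Reasoning)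
open import Relation.Nullary using (contradiction)
open import Relation.Nullary.Decidable using (decidable-stable; ¬¬-excluded-middle)
open import Relation.Nullary.Negation using (¬¬-map; ¬¬-Monad)
open import Relation.Unary using (Decidable)

module _ {A : Set} {_#_ : A → A → Set} where

  AllPairs-lookup : ∀ {xs} → AllPairs _#_ xs → ∀ {i j} → i <ᶠ j →
                    lookup xs i # lookup xs j
  AllPairs-lookup (rx ∷ _)   {zero}  {suc j} _ = All.lookup rx (∈-lookup j)
  AllPairs-lookup (_ ∷ rxs)  {suc i} {suc j} (s≤s i<j) = AllPairs-lookup rxs i<j

  length≤-by-code : ∀ {P : A → Set} {B xs} (code : ∀ {x} → P x → ℕ) →
                    (∀ {x} (px : P x) → code px < B) →
                    (∀ {x y} (px : P x) (py : P y) → x # y → code px ≢ code py) →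
                    All P xs → AllPairs _#_ xs → length xs ≤ B
  length≤-by-code {B = B} {xs} code code< separated pxs rxs = Fin.injective⇒≤ f-injective
    where
    f : Fin (length xs) → Fin B
    f i = fromℕ< (code< (All.lookup pxs (∈-lookup i)))

    f-injective : Injective _≡_ _≡_ f
    f-injective {i} {j} fi≡fj with Fin.<-cmp i j
    ... | tri< i<j _ _ = contradiction (Fin.fromℕ<-injective _ _ _ _ fi≡fj)
                                       (separated _ _ (AllPairs-lookup rxs i<j))
    ... | tri≈ _ i≡j _ = i≡j
    ... | tri> _ _ j<i = contradiction (Fin.fromℕ<-injective _ _ _ _ (sym fi≡fj))
                                       (separated _ _ (AllPairs-lookup rxs j<i))

radix-injective : ∀ {B a a′ q q′} → a < B → a′ < B →
                  a + B * q ≡ a′ + B * q′ → a ≡ a′ × q ≡ q′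
radix-injective {B@(suc _)} {a} {a′} {q} {q′} a<B a′<B eq =
  a≡a′ , *-cancelˡ-≡ q q′ B (+-cancelˡ-≡ a _ _ (trans eq (cong (_+ B * q′) (sym a≡a′))))
  where
  open ≡-Reasoning

  digit : ∀ {b} r → b < B → (b + B * r) % B ≡ b
  digit {b} r b<B = begin
    (b + B * r) % B ≡⟨ cong (λ m → (b + m) % B) (*-comm B r) ⟩
    (b + r * B) % B ≡⟨ [m+kn]%n≡m%n b r B ⟩
    b % B           ≡⟨ m<n⇒m%n≡m b<B ⟩
    b               ∎

  a≡a′ : a ≡ a′
  a≡a′ = trans (sym (digit q a<B)) (trans (cong (_% B) eq) (digit q′ a′<B))

radix-< : ∀ {B M a q} → a < B → q < M → a + B * q < B * M
radix-< {B} {M} {a} {q} a<B q<M = begin-strict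
  a + B * q     <⟨ +-monoˡ-< (B * q) a<B ⟩
  B + B * q     ≡⟨ *-suc B q ⟨
  B * suc q     ≤⟨ *-monoʳ-≤ B q<M ⟩
  B * M         ∎
  where open ≤-Reasoning

bit : Bool → ℕ
bit false = 0
bit true  = 1

bit<2 : ∀ b → bit b < 2
bit<2 false = s≤s z≤n
bit<2 true  = s≤s (s≤s z≤n)

bit-injective : ∀ {b c} → bit b ≡ bit c → b ≡ c
bit-injective {false} {false} _ = refl
bit-injective {true}  {true}  _ = refl

bits-injective : ∀ {b c m n} → bit b + 2 * m ≡ bit c + 2 * n → b ≡ c × m ≡ n
bits-injective {b} {c} eq with radix-injective (bit<2 b) (bit<2 c) eq
... | b≡c , m≡n = bit-injective b≡c , m≡n

vecCode : ∀ {n} → Vec Bool n → ℕ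
vecCode []      = 0
vecCode (b ∷ v) = bit b + 2 * vecCode v

vecCode< : ∀ {n} (v : Vec Bool n) → vecCode v < 2 ^ n
vecCode< []      = s≤s z≤n
vecCode< (b ∷ v) = radix-< (bit<2 b) (vecCode< v)

vecCode-injective : ∀ {n} {v w : Vec Bool n} → vecCode v ≡ vecCode w → v ≡ w
vecCode-injective {v = []}    {[]}    _  = refl
vecCode-injective {v = b ∷ v} {c ∷ w} eq with bits-injective {b} {c} eq
... | refl , v≡w = cong (b ∷_) (vecCode-injective v≡w)

-- Bijective base-2 numeration: the strings of length < ℓ get the codes < 2^ℓ - 1.
listCode : List Bool → ℕ
listCode []       = 0
listCode (b ∷ bs) = suc (bit b + 2 * listCode bs)

suc-listCode< : ∀ bs → suc (listCode bs) < 2 ^ suc (length bs)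
suc-listCode< []       = s≤s (s≤s z≤n)
suc-listCode< (b ∷ bs) = subst (_< 2 * 2 ^ suc (length bs)) suc-code≡
                               (radix-< (bit<2 b) (suc-listCode< bs))
  where
  c = listCode bs
  suc-code≡ : bit b + 2 * suc c ≡ suc (suc (bit b + 2 * c))
  suc-code≡ = trans (cong (bit b +_) (*-suc 2 c))
                    (trans (+-suc (bit b) (suc (2 * c))) (cong suc (+-suc (bit b) (2 * c))))

listCode-injective : ∀ {bs cs} → listCode bs ≡ listCode cs → bs ≡ cs
listCode-injective {[]}     {[]}     _  = refl
listCode-injective {b ∷ bs} {c ∷ cs} eq with bits-injective {b} {c} (suc-injective eq)
... | refl , bs≡cs = cong (b ∷_) (listCode-injective bs≡cs)

module _ {M : TM} {p y : List Bool} where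

  step-halted : ∀ {c} → TM.halting M (state c) ≡ true → step M p y c ≡ c
  step-halted h rewrite h = refl

  run-halted : ∀ {t t′} → TM.halting M (state (run M p y t)) ≡ true →
               t ≤′ t′ → run M p y t′ ≡ run M p y t
  run-halted h ≤′-refl        = refl
  run-halted h (≤′-step t≤′t′) = trans (cong (step M p y) (run-halted h t≤′t′)) (step-halted h)

TapeOutput-functional : ∀ {tape x x′} → TapeOutput tape x → TapeOutput tape x′ → x ≡ x′
TapeOutput-functional {x = []}    {[]}     _        _          = refl
TapeOutput-functional {x = []}    {_ ∷ _}  blank     (cell , _) with trans (sym blank) cell
... | ()
TapeOutput-functional {x = _ ∷ _} {[]}     (cell , _) blank    with trans (sym blank) cell
... | ()
TapeOutput-functional {x = _ ∷ _} {_ ∷ _}  (cell , rest) (cell′ , rest′) =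
  cong₂ _∷_ (just-injective (trans (sym cell) cell′)) (TapeOutput-functional rest rest′)

Computes-functional : ∀ {M p y s s′ x x′} →
                      Computes M p y s x → Computes M p y s′ x′ → x ≡ x′
Computes-functional (t , h , _ , out) (t′ , h′ , _ , out′) with ≤-total t t′
... | inj₁ t≤t′ = TapeOutput-functional out
                    (subst (λ c → TapeOutput (work c) _) (run-halted h (≤⇒≤′ t≤t′)) out′)
... | inj₂ t′≤t = sym (TapeOutput-functional out′
                    (subst (λ c → TapeOutput (work c) _) (run-halted h′ (≤⇒≤′ t′≤t)) out))

Computes-mono : ∀ {M p y s s′ x} → s ≤ s′ → Computes M p y s x → Computes M p y s′ x
Computes-mono s≤s′ (t , h , space , out) = t , h , (λ t′ t′≤t → <-≤-trans (space t′ t′≤t) s≤s′) , out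

SetS-length< : ∀ (U : TM) n k b s {xs} → Unique xs → All (SetS U n k b s) xs →
               length xs < 2 ^ k
SetS-length< U n k b s uniq xs∈S =
  m≤pred[n]⇒suc[m]≤n {{m^n≢0 2 k}} (length≤-by-code code code< separated xs∈S uniq)
  where
  code : ∀ {x} → SetS U n k b s x → ℕ
  code (p , _ , _) = listCode p

  code< : ∀ {x} (px : SetS U n k b s x) → code px < pred (2 ^ k)
  code< (p , |p|<k , _) = <⇒≤pred (<-≤-trans (suc-listCode< p) (^-monoʳ-≤ 2 |p|<k))

  separated : ∀ {x x′} (px : SetS U n k b s x) (px′ : SetS U n k b s x′) →
              x ≢ x′ → code px ≢ code px′
  separated {x} {x′} (p , _ , U[p,b]=x) (p′ , _ , U[p′,b]=x′) x≢x′ eq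
    with listCode-injective eq
  ... | refl = x≢x′ (trans (sym (Vec.cast-is-id refl x))
                            (Vec.toList-injective refl x x′ (Computes-functional U[p,b]=x U[p′,b]=x′)))

allBits : ∀ n → List (Vec Bool n)
allBits zero    = [] ∷ []
allBits (suc n) = cartesianProductWith Data.Vec._∷_ (true ∷ false ∷ []) (allBits n)

∈-allBits : ∀ {n} (v : Vec Bool n) → v ∈ allBits n
∈-allBits []      = here refl
∈-allBits (b ∷ v) = ∈-cartesianProductWith⁺ Data.Vec._∷_ (∈-bits b) (∈-allBits v)
  where
  ∈-bits : ∀ b → b ∈ true ∷ false ∷ []
  ∈-bits true  = here refl
  ∈-bits false = there (here refl)

allBits-unique : ∀ n → Unique (allBits n)
allBits-unique zero    = [] ∷ []
allBits-unique (suc n) =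
  Unique.cartesianProductWith⁺ Data.Vec._∷_ Vec.∷-injective
    (((λ ()) ∷ []) ∷ [] ∷ []) (allBits-unique n)

¬¬-decidable : ∀ {n} (P : Vec Bool n → Set) → ¬ ¬ Decidable P
¬¬-decidable {n} P =
  ¬¬-map (λ decs v → All.lookup decs (∈-allBits v))
         (All.sequenceM 0ℓ ¬¬-Monad (All.tabulate {xs = allBits n} (λ _ → ¬¬-excluded-middle)))

card : ∀ {n} {P : Vec Bool n → Set} → Decidable P → ℕ
card {n} P? = length (filter P? (allBits n))

⊆∧card≡⇒⊇ : ∀ {n} {P Q : Vec Bool n → Set} (P? : Decidable P) (Q? : Decidable Q) →
            (∀ {v} → P v → Q v) → card P? ≡ card Q? → ∀ {v} → Q v → P v
⊆∧card≡⇒⊇ {n} P? Q? P⊆Q |P|≡|Q| {v} qv =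
  proj₂ (∈-filter⁻ P? {xs = allBits n}
          (subst (v ∈_) (sym filterP≡filterQ) (∈-filter⁺ Q? (∈-allBits v) qv)))
  where
  filterP⊆filterQ : filter P? (allBits n) ⊆ filter Q? (allBits n)
  filterP⊆filterQ = Sublist.filter⁺ P? Q? (λ { refl → P⊆Q }) (⊆-refl {x = allBits n})

  filterP≡filterQ : filter P? (allBits n) ≡ filter Q? (allBits n)
  filterP≡filterQ = ≋⇒≡ (Sublist.to-≋ |P|≡|Q| filterP⊆filterQ)

module _ (U : TM) (n k : ℕ) where

  private
    S : Vec Bool n × ℕ → Vec Bool n → Set
    S (b , s) = SetS U n k b s

    Distinct : Vec Bool n × ℕ → Vec Bool n × ℕ → Set
    Distinct e e′ = ¬ SameSet (S e) (S e′)

  SetS-mono : ∀ {b s s′} → s ≤ s′ → ∀ {x} → SetS U n k b s x → SetS U n k b s′ x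
  SetS-mono s≤s′ (p , |p|<k , U[p,b]=x) = p , |p|<k , Computes-mono s≤s′ U[p,b]=x

  card-SetS< : k < n → ∀ {b s} (S? : Decidable (SetS U n k b s)) → card S? < 2 ^ n
  card-SetS< k<n {b} {s} S? =
    <-trans (SetS-length< U n k b s (Unique.filter⁺ S? (allBits-unique n)) (all-filter S? (allBits n)))
            (^-monoʳ-< 2 (s≤s (s≤s z≤n)) k<n)

  SetS-determined-by-card : ∀ {b s s′} (S? : Decidable (SetS U n k b s))
                            (S′? : Decidable (SetS U n k b s′)) →
                            card S? ≡ card S′? → SameSet (SetS U n k b s) (SetS U n k b s′)
  SetS-determined-by-card {s = s} {s′} S? S′? |S|≡|S′| x with ≤-total s s′
  ... | inj₁ s≤s′ = SetS-mono s≤s′ , ⊆∧card≡⇒⊇ S? S′? (SetS-mono s≤s′) |S|≡|S′|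
  ... | inj₂ s′≤s = ⊆∧card≡⇒⊇ S′? S? (SetS-mono s′≤s) (sym |S|≡|S′|) , SetS-mono s′≤s

  distinct-SetS-length≤ : k < n → ∀ {bss} → AllPairs Distinct bss → length bss ≤ 2 ^ n * 2 ^ n
  distinct-SetS-length≤ k<n {bss} distinct =
    decidable-stable (length bss ≤? 2 ^ n * 2 ^ n)
      (¬¬-map (λ decs → length≤-by-code code code< separated decs distinct)
              (All.sequenceM 0ℓ ¬¬-Monad (All.tabulate (λ {e} _ → ¬¬-decidable (S e)))))
    where
    code : ∀ {e} → Decidable (S e) → ℕ
    code {b , _} S? = card S? + 2 ^ n * vecCode b

    code< : ∀ {e} (S? : Decidable (S e)) → code S? < 2 ^ n * 2 ^ n
    code< {b , _} S? = radix-< (card-SetS< k<n S?) (vecCode< b)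

    separated : ∀ {e e′} (S? : Decidable (S e)) (S′? : Decidable (S e′)) →
                Distinct e e′ → code S? ≢ code S′?
    separated {b , _} {b′ , _} S? S′? S≠S′ eq
      with radix-injective (card-SetS< k<n S?) (card-SetS< k<n S′?) eq
    ... | |S|≡|S′| , b≡b′ with vecCode-injective {v = b} {b′} b≡b′
    ... | refl = S≠S′ (SetS-determined-by-card S? S′? |S|≡|S′|)

lemma2 : (U : TM) → Optimal U →
    ((n k : ℕ) → 1 < k → k < n → (b : Vec Bool n) → (s : ℕ) →
       (xs : List (Vec Bool n)) → Unique xs → All (SetS U n k b s) xs →
       length xs < 2 ^ k)
    × ∃ λ c → (n k : ℕ) → 1 < k → k < n →
       (bss : List (Vec Bool n × ℕ)) →
       AllPairs (λ bs bs′ → ¬ SameSet (SetS U n k (proj₁ bs) (proj₂ bs))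
                                      (SetS U n k (proj₁ bs′) (proj₂ bs′))) bss →
       length bss ≤ 2 ^ (c * n)
lemma2 U _ =
    (λ n k _ _ b s xs → SetS-length< U n k b s)
  , 2
  , λ n k _ k<n bss distinct →
      subst (length bss ≤_) (2^n*2^n≡2^[2*n] {n}) (distinct-SetS-length≤ U n k k<n distinct)
  where
  2^n*2^n≡2^[2*n] : ∀ {n} → 2 ^ n * 2 ^ n ≡ 2 ^ (2 * n)
  2^n*2^n≡2^[2*n] {n} = trans (cong (λ m → 2 ^ n * 2 ^ m) (sym (+-identityʳ n)))
                              (sym (^-distribˡ-+-* 2 n (n + 0)))
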